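{- Let $p$ be an odd prime. Then $$\sum_{n=1}^{p-1}\frac{nS_n}{8^n}\equiv0\pmod{p^2}.$$
   Context: For $n\ge0$, $S_n=\sum_{k=0}^{\lfloor n/2\rfloor}\binom{2k}{k}^2\binom{n}{2k}4^{n-2k}=\sum_{k=0}^n\binom{n}{k}\binom{2k}{k}\binom{2n-2k}{n-k}$. Congruences between rationals with denominators prime to $p$ are taken in the ring of such rationals. -}

module Defs where

open import Data.Nat using (ℕ; zero; suc; _+_; _*_; _∸_; _^_; _/_)
open import Data.Nat.Properties using (m^n≢0)
open import Data.Nat.Combinatorics using (_C_)
open import Data.Nat.Divisibility using (_∣_)
open import Data.Product using (Σ; _×_)
open import Relation.Nullary using (¬_)
open import Relation.Binary.PropositionalEquality using (_≡_)
open import Data.Integer as ℤ using (ℤ; +_)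
open import Data.Rational as ℚ using (ℚ)

sumTo : ℕ → (ℕ → ℕ) → ℕ
sumTo zero    f = f 0
sumTo (suc n) f = sumTo n f + f (suc n)

sumℚ1 : ℕ → (ℕ → ℚ) → ℚ
sumℚ1 zero    f = ℚ.0ℚ
sumℚ1 (suc m) f = sumℚ1 m f ℚ.+ f (suc m)

S : ℕ → ℕ
S n = sumTo (n / 2) (λ k → ((2 * k) C k) * ((2 * k) C k) * (n C (2 * k)) * 4 ^ (n ∸ 2 * k))

ofℕ : ℕ → ℚ
ofℕ n = (+ n) ℚ./ 1

-- a ≡ b (mod m) in the ring of rationals whose denominators are prime to p:
-- a - b = m * r for some rational r with p ∤ denominator(r)  (r in lowest terms).
CongMod : (p : ℕ) → ℚ → ℚ → ℕ → Set
CongMod p a b m = Σ ℚ (λ r → ¬ (p ∣ ℚ.ℚ.denominatorℕ r) × (a ℚ.- b ≡ ofℕ m ℚ.* r))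

term : ℕ → ℚ
term n = ((+ (n * S n)) ℚ./ (8 ^ n)) {{m^n≢0 8 n}}

module Submission where

-- Write T(m) = Σ_{n<m} n S_n 8^{m-1-n} (partial below), so that the sum in question is
-- T(p)/8^{p-1}.  The numbers S_n satisfy the three-term recurrence
--     (n+2)² S_{n+2} + 32 (n+1)² S_n = 4 (3n²+9n+7) S_{n+1},
-- proved by creative telescoping: each summand F(n,k) = C(2k,k)² C(n,2k) 4^{n-2k}
-- satisfies the same recurrence up to a difference G(n,k) - G(n,k+1) of an explicit
-- certificate G, which reduces to a pure identity between binomial coefficients.
-- Feeding the recurrence into the definition of T gives, by induction on m,
--     4 T(m+1) + 4 (m+1)² S_m = (m+1)² S_{m+1},
-- hence for m + 1 = p the sum equals p² · 2(S_p - 4 S_{p-1}) / 8^p.  Since p is odd,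
-- p does not divide 8^p, so the quotient is p-integral and the congruence follows.

open import Data.Nat
  using (ℕ; zero; suc; _+_; _*_; _∸_; _^_; _/_; _%_; _≤_; _<_; z≤n; s≤s; s≤s⁻¹; NonZero; _≤?_; pred)
open import Data.Nat.Properties
open import Data.Nat.Combinatorics
  using (_C_; nCk+nC[k+1]≡[n+1]C[k+1]; k>n⇒nCk≡0; nCk≡nC[n∸k]; nCn≡1)
open import Data.Nat.DivMod using (m≡m%n+[m/n]*n; m%n<n; m/n≡1+[m∸n]/n; /-monoˡ-≤)
open import Data.Nat.Divisibility using (_∣_; divides; ∣⇒≤; ∣1⇒≡1; ∣-refl; ∣-trans)
open import Data.Nat.Primality using (Prime; euclidsLemma; ¬prime[1]; prime⇒nonTrivial)
open import Data.Nat.Base using (nonTrivial⇒n>1)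
open import Data.Nat.GCD using (gcd)
open import Data.Nat.Tactic.RingSolver using (solve-∀)
open import Data.Integer as ℤ using (+_)
import Data.Integer.Properties as ℤP
open import Data.Rational as ℚ using (ℚ)
import Data.Rational.Properties as ℚP
open import Data.Rational.Unnormalised as ℚᵘ using (mkℚᵘ; *≡*)
import Data.Rational.Unnormalised.Properties as ℚᵘP
open import Data.Product using (_,_)
open import Data.Sum using (inj₁; inj₂)
open import Data.Empty using (⊥-elim)
open import Relation.Nullary using (¬_; yes; no)
open import Relation.Binary.PropositionalEquality
open import Defs

-- Binomial coefficients defined by Pascal's rule; this form supports induction,
-- and it agrees with the library's  _C_  used in the definition of S.
binom : ℕ → ℕ → ℕ
binom n       zero    = 1
binom zero    (suc k) = 0
binom (suc n) (suc k) = binom n k + binom n (suc k)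

binom≡C : ∀ n k → binom n k ≡ n C k
binom≡C n       zero    = sym (trans (nCk≡nC[n∸k] {0} {n} z≤n) (nCn≡1 n))
binom≡C zero    (suc k) = sym (k>n⇒nCk≡0 {0} {suc k} (s≤s z≤n))
binom≡C (suc n) (suc k) =
  trans (cong₂ _+_ (binom≡C n k) (binom≡C n (suc k))) (nCk+nC[k+1]≡[n+1]C[k+1] n k)

binom-vanish : ∀ n k → n < k → binom n k ≡ 0
binom-vanish zero    (suc k) _         = refl
binom-vanish (suc n) (suc k) (s≤s n<k) =
  cong₂ _+_ (binom-vanish n k n<k) (binom-vanish n (suc k) (m<n⇒m<1+n n<k))

binom-one : ∀ n → binom n 1 ≡ n
binom-one zero    = refl
binom-one (suc n) = cong suc (binom-one n)

binom-absorb : ∀ n k → suc k * binom (suc n) (suc k) ≡ suc n * binom n k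
binom-absorb zero    zero    = refl
binom-absorb zero    (suc k) = *-zeroʳ (suc (suc k))
binom-absorb (suc n) zero    = trans (+-identityʳ _) (trans (binom-one (2 + n)) (sym (*-identityʳ _)))
binom-absorb (suc n) (suc k) = begin
    (2 + k) * (binom (suc n) (suc k) + binom (suc n) (2 + k))
  ≡⟨ split (suc k) (binom (suc n) (suc k)) (binom (suc n) (2 + k)) ⟩
    suc k * binom (suc n) (suc k) + binom (suc n) (suc k) + (2 + k) * binom (suc n) (2 + k)
  ≡⟨ cong₂ (λ a b → a + binom (suc n) (suc k) + b) (binom-absorb n k) (binom-absorb n (suc k)) ⟩
    suc n * binom n k + (binom n k + binom n (suc k)) + suc n * binom n (suc k)
  ≡⟨ merge n (binom n k) (binom n (suc k)) ⟩
    (2 + n) * (binom n k + binom n (suc k))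
  ∎
  where
  open ≡-Reasoning
  split : ∀ a x y → suc a * (x + y) ≡ a * x + x + suc a * y
  split = solve-∀
  merge : ∀ a x y → suc a * x + (x + y) + suc a * y ≡ (2 + a) * (x + y)
  merge = solve-∀

-- Neighbouring coefficients:  (j+1) C(m,j+1) = (m-j) C(m,j), in additive form.
binom-next : ∀ m j → suc j * binom m (suc j) + j * binom m j ≡ m * binom m j
binom-next zero    zero    = refl
binom-next zero    (suc j) = cong₂ _+_ (*-zeroʳ (2 + j)) (*-zeroʳ (suc j))
binom-next (suc n) zero    =
  trans (+-identityʳ _) (trans (+-identityʳ _) (trans (binom-one (suc n)) (sym (*-identityʳ (suc n)))))
binom-next (suc n) (suc i) = begin
    (2 + i) * binom (suc n) (2 + i) + suc i * binom (suc n) (suc i)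
  ≡⟨ cong₂ _+_ (binom-absorb n (suc i)) (binom-absorb n i) ⟩
    suc n * binom n (suc i) + suc n * binom n i
  ≡⟨ factor (suc n) (binom n (suc i)) (binom n i) ⟩
    suc n * (binom n i + binom n (suc i))
  ∎
  where
  open ≡-Reasoning
  factor : ∀ a x y → a * x + a * y ≡ a * (y + x)
  factor = solve-∀

central : ℕ → ℕ
central k = binom (2 * k) k

two-suc : ∀ k → 2 * suc k ≡ 2 + 2 * k
two-suc = solve-∀

central-step : ∀ k → suc k * central (suc k) ≡ 2 * (suc (2 * k) * central k)
central-step k = begin
    suc k * binom (2 * suc k) (suc k)
  ≡⟨ cong (λ t → suc k * binom t (suc k)) (two-suc k) ⟩
    suc k * binom (2 + N) (suc k)
  ≡⟨ binom-absorb (suc N) k ⟩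
    (2 + N) * binom (suc N) k
  ≡⟨ cong (_* binom (suc N) k) (sym (two-suc k)) ⟩
    2 * suc k * binom (suc N) k
  ≡⟨ *-assoc 2 (suc k) _ ⟩
    2 * (suc k * binom (suc N) k)
  ≡⟨ cong (2 *_) symmetric ⟩
    2 * (suc N * binom N k)
  ∎
  where
  open ≡-Reasoning
  N = 2 * k
  -- C(2k+1,k+1) = C(2k+1,k), multiplied by k+1 and combined with absorption
  symmetric : suc k * binom (suc N) k ≡ suc N * binom N k
  symmetric = trans (sym (+-cancelʳ-≡ _ _ _ (trans (binom-next (suc N) k) (halves k (binom (suc N) k)))))
                    (binom-absorb N k)
    where
    halves : ∀ k x → suc (2 * k) * x ≡ suc k * x + k * x
    halves = solve-∀

central-square-step : ∀ k →
  2 * suc k * (2 * suc k) * (central (suc k) * central (suc k))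
    ≡ 16 * (suc (2 * k) * suc (2 * k)) * (central k * central k)
central-square-step k = begin
    2 * suc k * (2 * suc k) * (c' * c')
  ≡⟨ double (suc k) c' ⟩
    4 * ((suc k * c') * (suc k * c'))
  ≡⟨ cong (λ t → 4 * (t * t)) (central-step k) ⟩
    4 * ((2 * (suc (2 * k) * central k)) * (2 * (suc (2 * k) * central k)))
  ≡⟨ expand (suc (2 * k)) (central k) ⟩
    16 * (suc (2 * k) * suc (2 * k)) * (central k * central k)
  ∎
  where
  open ≡-Reasoning
  c' = central (suc k)
  double : ∀ a x → (2 * a) * (2 * a) * (x * x) ≡ 4 * ((a * x) * (a * x))
  double = solve-∀
  expand : ∀ a y → 4 * ((2 * (a * y)) * (2 * (a * y))) ≡ 16 * (a * a) * (y * y)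
  expand = solve-∀

-- The coefficient identity behind the recurrence (used at j = 2k):
--   (n+2)² C(n+2,j) + 2(n+1)² C(n,j) + (j+1)² C(n+1,j+1) = (3n²+9n+7) C(n+1,j) + j² C(n+1,j-1).
-- For j = i+1 it is a linear consequence of absorption and two instances of binom-next,
-- with u,v,w = C(n+1,i), C(n+1,i+1), C(n+1,i+2), z = C(n,i+1) and C(n+2,i+1) = u + v.
binom-identity-certificate : ∀ n i u v w z →
  (2 + i) * w ≡ suc n * z →
  (2 + i) * w + suc i * v ≡ suc n * v →
  suc i * v + i * u ≡ suc n * u →
  (2 + n) * (2 + n) * (u + v) + 2 * (suc n * suc n) * z + (2 + i) * (2 + i) * w
    ≡ (3 * (n * n) + 9 * n + 7) * v + suc i * suc i * u
binom-identity-certificate n i u v w z absorb next₁ next₀ =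
  +-cancelʳ-≡ multiplier _ _ (begin
      (2 + n) * (2 + n) * (u + v) + 2 * (suc n * suc n) * z + (2 + i) * (2 + i) * w + multiplier
    ≡⟨ cong (λ t → (2 + n) * (2 + n) * (u + v) + t + (2 + i) * (2 + i) * w + multiplier)
            (trans (eliminate-z n z) (cong (2 * suc n *_) (sym absorb))) ⟩
      (2 + n) * (2 + n) * (u + v) + 2 * suc n * ((2 + i) * w) + (2 + i) * (2 + i) * w + multiplier
    ≡⟨ combination n i u v w ⟩
      (3 * (n * n) + 9 * n + 7) * v + suc i * suc i * u + multiplier′
    ≡⟨ cong (λ t → (3 * (n * n) + 9 * n + 7) * v + suc i * suc i * u + t) (sym multipliers-agree) ⟩
      (3 * (n * n) + 9 * n + 7) * v + suc i * suc i * u + multiplier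
    ∎)
  where
  open ≡-Reasoning
  multiplier multiplier′ : ℕ
  multiplier  = (2 * suc n + i + 2) * (suc n * v) + (suc n + i + 2) * (suc i * v + i * u)
  multiplier′ = (2 * suc n + i + 2) * ((2 + i) * w + suc i * v) + (suc n + i + 2) * (suc n * u)
  multipliers-agree : multiplier ≡ multiplier′
  multipliers-agree = cong₂ (λ a b → (2 * suc n + i + 2) * a + (suc n + i + 2) * b) (sym next₁) next₀
  eliminate-z : ∀ n z → 2 * (suc n * suc n) * z ≡ 2 * suc n * (suc n * z)
  eliminate-z = solve-∀
  combination : ∀ n i u v w →
    (2 + n) * (2 + n) * (u + v) + 2 * suc n * ((2 + i) * w) + (2 + i) * (2 + i) * w
      + ((2 * suc n + i + 2) * (suc n * v) + (suc n + i + 2) * (suc i * v + i * u))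
    ≡ (3 * (n * n) + 9 * n + 7) * v + suc i * suc i * u
      + ((2 * suc n + i + 2) * ((2 + i) * w + suc i * v) + (suc n + i + 2) * (suc n * u))
  combination = solve-∀

binom-identity : ∀ n j →
  (2 + n) * (2 + n) * binom (2 + n) j + 2 * (suc n * suc n) * binom n j
    + suc j * suc j * binom (suc n) (suc j)
  ≡ (3 * (n * n) + 9 * n + 7) * binom (suc n) j + j * j * binom (suc n) (j ∸ 1)
binom-identity n zero rewrite binom-one n = at-zero n
  where
  at-zero : ∀ n → (2 + n) * (2 + n) * 1 + 2 * (suc n * suc n) * 1 + 1 * 1 * suc n
                ≡ (3 * (n * n) + 9 * n + 7) * 1 + 0
  at-zero = solve-∀
binom-identity n (suc i) =
  binom-identity-certificate n i
    (binom (suc n) i) (binom (suc n) (suc i)) (binom (suc n) (2 + i)) (binom n (suc i))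
    (binom-absorb n (suc i)) (binom-next (suc n) (suc i)) (binom-next (suc n) i)

-- Attaching the weight 4^{n-j} to C(n,j): a further factor 4^d moves n to d + n
-- (trivially so when j > n, where the coefficient vanishes).
weight-shift : ∀ d n j → binom n j * 4 ^ (n ∸ j) * 4 ^ d ≡ binom n j * 4 ^ ((d + n) ∸ j)
weight-shift d n j with j ≤? n
... | no  j≰n rewrite binom-vanish n j (≰⇒> j≰n) = refl
... | yes j≤n rewrite +-∸-assoc d j≤n | ^-distribˡ-+-* 4 d (n ∸ j) =
  trans (*-assoc (binom n j) _ _) (cong (binom n j *_) (*-comm (4 ^ (n ∸ j)) (4 ^ d)))

weighted-identity : ∀ n j →
  (2 + n) * (2 + n) * (binom (2 + n) j * 4 ^ ((2 + n) ∸ j))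
    + 32 * (suc n * suc n) * (binom n j * 4 ^ (n ∸ j))
    + 16 * (suc j * suc j) * (binom (suc n) (suc j) * 4 ^ (n ∸ j))
  ≡ 4 * (3 * (n * n) + 9 * n + 7) * (binom (suc n) j * 4 ^ (suc n ∸ j))
    + j * j * binom (suc n) (j ∸ 1) * 4 ^ ((2 + n) ∸ j)
weighted-identity n j = begin
    α * (C₂ * E) + 32 * β * (C₀ * e₀) + 16 * γ * (Cₚ * e₀)
  ≡⟨ spread α β γ C₂ E C₀ e₀ Cₚ ⟩
    α * (C₂ * E) + 2 * β * (C₀ * e₀ * 16) + γ * (Cₚ * e₀ * 16)
  ≡⟨ cong₂ (λ x y → α * (C₂ * E) + 2 * β * x + γ * y) (weight-shift 2 n j) (weight-shift 2 (suc n) (suc j)) ⟩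
    α * (C₂ * E) + 2 * β * (C₀ * E) + γ * (Cₚ * E)
  ≡⟨ collect α β γ C₂ C₀ Cₚ E ⟩
    (α * C₂ + 2 * β * C₀ + γ * Cₚ) * E
  ≡⟨ cong (_* E) (binom-identity n j) ⟩
    (δ * C₁ + j * j * Cₘ) * E
  ≡⟨ distribute δ C₁ (j * j) Cₘ E ⟩
    δ * (C₁ * E) + j * j * Cₘ * E
  ≡⟨ cong (λ x → δ * x + j * j * Cₘ * E) (sym (weight-shift 1 (suc n) j)) ⟩
    δ * (C₁ * e₁ * 4) + j * j * Cₘ * E
  ≡⟨ cong (_+ j * j * Cₘ * E) (pull-four δ C₁ e₁) ⟩
    4 * δ * (C₁ * e₁) + j * j * Cₘ * E
  ∎
  where
  open ≡-Reasoning
  α = (2 + n) * (2 + n)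
  β = suc n * suc n
  γ = suc j * suc j
  δ = 3 * (n * n) + 9 * n + 7
  C₂ = binom (2 + n) j
  C₁ = binom (suc n) j
  C₀ = binom n j
  Cₚ = binom (suc n) (suc j)
  Cₘ = binom (suc n) (j ∸ 1)
  E  = 4 ^ ((2 + n) ∸ j)
  e₁ = 4 ^ (suc n ∸ j)
  e₀ = 4 ^ (n ∸ j)
  spread : ∀ α β γ C₂ E C₀ e₀ Cₚ →
    α * (C₂ * E) + 32 * β * (C₀ * e₀) + 16 * γ * (Cₚ * e₀)
      ≡ α * (C₂ * E) + 2 * β * (C₀ * e₀ * 16) + γ * (Cₚ * e₀ * 16)
  spread = solve-∀
  collect : ∀ α β γ C₂ C₀ Cₚ E →
    α * (C₂ * E) + 2 * β * (C₀ * E) + γ * (Cₚ * E) ≡ (α * C₂ + 2 * β * C₀ + γ * Cₚ) * E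
  collect = solve-∀
  distribute : ∀ δ C₁ jj Cₘ E → (δ * C₁ + jj * Cₘ) * E ≡ δ * (C₁ * E) + jj * Cₘ * E
  distribute = solve-∀
  pull-four : ∀ δ C₁ e₁ → δ * (C₁ * e₁ * 4) ≡ 4 * δ * (C₁ * e₁)
  pull-four = solve-∀

summand : ℕ → ℕ → ℕ
summand n k = central k * central k * binom n (2 * k) * 4 ^ (n ∸ 2 * k)

certificate : ℕ → ℕ → ℕ
certificate n k =
  2 * k * (2 * k) * (central k * central k) * binom (suc n) (2 * k ∸ 1) * 4 ^ ((2 + n) ∸ 2 * k)

certificate-step : ∀ n k → certificate n (suc k)
  ≡ 16 * (suc (2 * k) * suc (2 * k)) * (central k * central k)
      * binom (suc n) (suc (2 * k)) * 4 ^ (n ∸ 2 * k)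
certificate-step n k =
  cong₂ (λ a t → a * binom (suc n) (t ∸ 1) * 4 ^ ((2 + n) ∸ t)) (central-square-step k) (two-suc k)

certificate-vanish : ∀ n k → n < 2 * k → certificate n (suc k) ≡ 0
certificate-vanish n k n<2k = begin
    certificate n (suc k)
  ≡⟨ certificate-step n k ⟩
    a * binom (suc n) (suc (2 * k)) * 4 ^ (n ∸ 2 * k)
  ≡⟨ cong (λ t → a * t * 4 ^ (n ∸ 2 * k)) (binom-vanish (suc n) (suc (2 * k)) (s≤s n<2k)) ⟩
    a * 0 * 4 ^ (n ∸ 2 * k)
  ≡⟨ cong (_* 4 ^ (n ∸ 2 * k)) (*-zeroʳ a) ⟩
    0
  ∎
  where
  open ≡-Reasoning
  a = 16 * (suc (2 * k) * suc (2 * k)) * (central k * central k)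

summand-recurrence : ∀ n k →
  (2 + n) * (2 + n) * summand (2 + n) k + 32 * (suc n * suc n) * summand n k + certificate n (suc k)
    ≡ 4 * (3 * (n * n) + 9 * n + 7) * summand (suc n) k + certificate n k
summand-recurrence n k = begin
    α * (c * C₂ * E) + 32 * β * (c * C₀ * e₀) + certificate n (suc k)
  ≡⟨ cong (λ t → α * (c * C₂ * E) + 32 * β * (c * C₀ * e₀) + t) (certificate-step n k) ⟩
    α * (c * C₂ * E) + 32 * β * (c * C₀ * e₀) + 16 * γ * c * Cₚ * e₀
  ≡⟨ factor-left α β γ c C₂ E C₀ e₀ Cₚ ⟩
    c * (α * (C₂ * E) + 32 * β * (C₀ * e₀) + 16 * γ * (Cₚ * e₀))
  ≡⟨ cong (c *_) (weighted-identity n (2 * k)) ⟩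
    c * (4 * δ * (C₁ * e₁) + 2 * k * (2 * k) * Cₘ * E)
  ≡⟨ factor-right δ c C₁ e₁ (2 * k * (2 * k)) Cₘ E ⟩
    4 * δ * (c * C₁ * e₁) + 2 * k * (2 * k) * c * Cₘ * E
  ∎
  where
  open ≡-Reasoning
  α = (2 + n) * (2 + n)
  β = suc n * suc n
  γ = suc (2 * k) * suc (2 * k)
  δ = 3 * (n * n) + 9 * n + 7
  c = central k * central k
  C₂ = binom (2 + n) (2 * k)
  C₁ = binom (suc n) (2 * k)
  C₀ = binom n (2 * k)
  Cₚ = binom (suc n) (suc (2 * k))
  Cₘ = binom (suc n) (2 * k ∸ 1)
  E  = 4 ^ ((2 + n) ∸ 2 * k)
  e₁ = 4 ^ (suc n ∸ 2 * k)
  e₀ = 4 ^ (n ∸ 2 * k)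
  factor-left : ∀ α β γ c C₂ E C₀ e₀ Cₚ →
    α * (c * C₂ * E) + 32 * β * (c * C₀ * e₀) + 16 * γ * c * Cₚ * e₀
      ≡ c * (α * (C₂ * E) + 32 * β * (C₀ * e₀) + 16 * γ * (Cₚ * e₀))
  factor-left = solve-∀
  factor-right : ∀ δ c C₁ e₁ jj Cₘ E →
    c * (4 * δ * (C₁ * e₁) + jj * Cₘ * E) ≡ 4 * δ * (c * C₁ * e₁) + jj * c * Cₘ * E
  factor-right = solve-∀

sumTo-cong : ∀ K {f g : ℕ → ℕ} → (∀ k → f k ≡ g k) → sumTo K f ≡ sumTo K g
sumTo-cong zero    f≡g = f≡g 0
sumTo-cong (suc K) f≡g = cong₂ _+_ (sumTo-cong K f≡g) (f≡g (suc K))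

sumTo-linear : ∀ K a b (f g : ℕ → ℕ) →
  sumTo K (λ k → a * f k + b * g k) ≡ a * sumTo K f + b * sumTo K g
sumTo-linear zero    a b f g = refl
sumTo-linear (suc K) a b f g rewrite sumTo-linear K a b f g =
  regroup a b (sumTo K f) (sumTo K g) (f (suc K)) (g (suc K))
  where
  regroup : ∀ a b x y u v → a * x + b * y + (a * u + b * v) ≡ a * (x + u) + b * (y + v)
  regroup = solve-∀

sumTo-scale : ∀ K a (f : ℕ → ℕ) → sumTo K (λ k → a * f k) ≡ a * sumTo K f
sumTo-scale zero    a f = refl
sumTo-scale (suc K) a f rewrite sumTo-scale K a f = sym (*-distribˡ-+ a (sumTo K f) (f (suc K)))

sumTo-telescope : ∀ K (f g h : ℕ → ℕ) → (∀ k → f k + h (suc k) ≡ g k + h k) →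
  sumTo K f + h (suc K) ≡ sumTo K g + h 0
sumTo-telescope zero    f g h step = step 0
sumTo-telescope (suc K) f g h step = begin
    sumTo K f + f (suc K) + h (2 + K)
  ≡⟨ +-assoc (sumTo K f) _ _ ⟩
    sumTo K f + (f (suc K) + h (2 + K))
  ≡⟨ cong (_+_ (sumTo K f)) (step (suc K)) ⟩
    sumTo K f + (g (suc K) + h (suc K))
  ≡⟨ swap (sumTo K f) (g (suc K)) (h (suc K)) ⟩
    sumTo K f + h (suc K) + g (suc K)
  ≡⟨ cong (_+ g (suc K)) (sumTo-telescope K f g h step) ⟩
    sumTo K g + h 0 + g (suc K)
  ≡⟨ exchange (sumTo K g) (h 0) (g (suc K)) ⟩
    sumTo K g + g (suc K) + h 0
  ∎
  where
  open ≡-Reasoning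
  swap : ∀ a b c → a + (b + c) ≡ a + c + b
  swap = solve-∀
  exchange : ∀ a b c → a + b + c ≡ a + c + b
  exchange = solve-∀

sumTo-pad : ∀ {a} b (f : ℕ → ℕ) → (∀ k → a < k → f k ≡ 0) → a ≤ b → sumTo b f ≡ sumTo a f
sumTo-pad zero    f vanish z≤n = refl
sumTo-pad (suc b) f vanish a≤1+b with m≤n⇒m<n∨m≡n a≤1+b
... | inj₂ refl = refl
... | inj₁ a<1+b =
  trans (cong (_+_ (sumTo b f)) (vanish (suc b) a<1+b))
        (trans (+-identityʳ _) (sumTo-pad b f vanish (s≤s⁻¹ a<1+b)))

half< : ∀ m k → m / 2 < k → m < 2 * k
half< m k lt = begin-strict
    m
  ≡⟨ m≡m%n+[m/n]*n m 2 ⟩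
    m % 2 + m / 2 * 2
  <⟨ +-monoˡ-< (m / 2 * 2) (m%n<n m 2) ⟩
    2 + m / 2 * 2
  ≡⟨ double-suc (m / 2) ⟩
    2 * suc (m / 2)
  ≤⟨ *-monoʳ-≤ 2 lt ⟩
    2 * k
  ∎
  where
  open ≤-Reasoning
  double-suc : ∀ x → 2 + x * 2 ≡ 2 * suc x
  double-suc = solve-∀

S-as-sum : ∀ n K → n / 2 ≤ K → S n ≡ sumTo K (summand n)
S-as-sum n K n/2≤K = trans in-binom (sym (sumTo-pad K (summand n) vanish n/2≤K))
  where
  in-binom : S n ≡ sumTo (n / 2) (summand n)
  in-binom = sumTo-cong (n / 2) (λ k →
    cong₂ (λ c b → c * c * b * 4 ^ (n ∸ 2 * k)) (sym (binom≡C (2 * k) k)) (sym (binom≡C n (2 * k))))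
  vanish : ∀ k → n / 2 < k → summand n k ≡ 0
  vanish k lt rewrite binom-vanish n (2 * k) (half< n k lt) | *-zeroʳ (central k * central k) = refl

S-recurrence : ∀ n →
  (2 + n) * (2 + n) * S (2 + n) + 32 * (suc n * suc n) * S n ≡ 4 * (3 * (n * n) + 9 * n + 7) * S (suc n)
S-recurrence n = begin
    a₂ * S (2 + n) + a₀ * S n
  ≡⟨ cong₂ (λ x y → a₂ * x + a₀ * y) (S-as-sum (2 + n) K (≤-reflexive K≡)) (S-as-sum n K (n≤1+n (n / 2))) ⟩
    a₂ * sumTo K (summand (2 + n)) + a₀ * sumTo K (summand n)
  ≡⟨ sym (sumTo-linear K a₂ a₀ (summand (2 + n)) (summand n)) ⟩
    sumTo K (λ k → a₂ * summand (2 + n) k + a₀ * summand n k)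
  ≡⟨ sym (+-identityʳ _) ⟩
    sumTo K (λ k → a₂ * summand (2 + n) k + a₀ * summand n k) + 0
  ≡⟨ cong (_+_ (sumTo K (λ k → a₂ * summand (2 + n) k + a₀ * summand n k)))
          (sym (certificate-vanish n K (half< n K (n<1+n (n / 2))))) ⟩
    sumTo K (λ k → a₂ * summand (2 + n) k + a₀ * summand n k) + certificate n (suc K)
  ≡⟨ sumTo-telescope K _ _ (certificate n) (summand-recurrence n) ⟩
    sumTo K (λ k → a₁ * summand (suc n) k) + 0
  ≡⟨ +-identityʳ _ ⟩
    sumTo K (λ k → a₁ * summand (suc n) k)
  ≡⟨ sumTo-scale K a₁ (summand (suc n)) ⟩
    a₁ * sumTo K (summand (suc n))
  ≡⟨ cong (a₁ *_) (sym (S-as-sum (suc n) K (subst (suc n / 2 ≤_) K≡ (/-monoˡ-≤ 2 (n≤1+n (suc n)))))) ⟩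
    a₁ * S (suc n)
  ∎
  where
  open ≡-Reasoning
  a₂ = (2 + n) * (2 + n)
  a₀ = 32 * (suc n * suc n)
  a₁ = 4 * (3 * (n * n) + 9 * n + 7)
  K = suc (n / 2)
  K≡ : (2 + n) / 2 ≡ K
  K≡ = m/n≡1+[m∸n]/n {2 + n} {2} (s≤s (s≤s z≤n))

-- partial m = Σ_{n<m} n S_n 8^{m-1-n}, so that Σ_{n=1}^{M} n S_n / 8^n = partial (M+1) / 8^M.
partial : ℕ → ℕ
partial zero    = 0
partial (suc m) = 8 * partial m + m * S m

partial-identity : ∀ m → 4 * partial (suc m) + 4 * (suc m * suc m) * S m ≡ suc m * suc m * S (suc m)
partial-identity zero    = refl
partial-identity (suc m) = +-cancelʳ-≡ (32 * (suc m * suc m) * S m) _ _ (begin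
    4 * (8 * T + suc m * S₁) + 4 * ((2 + m) * (2 + m)) * S₁ + 32 * (suc m * suc m) * S m
  ≡⟨ regroup m T (S m) S₁ ⟩
    8 * (4 * T + 4 * (suc m * suc m) * S m) + 4 * suc m * S₁ + 4 * ((2 + m) * (2 + m)) * S₁
  ≡⟨ cong (λ t → 8 * t + 4 * suc m * S₁ + 4 * ((2 + m) * (2 + m)) * S₁) (partial-identity m) ⟩
    8 * (suc m * suc m * S₁) + 4 * suc m * S₁ + 4 * ((2 + m) * (2 + m)) * S₁
  ≡⟨ collect m S₁ ⟩
    4 * (3 * (m * m) + 9 * m + 7) * S₁
  ≡⟨ sym (S-recurrence m) ⟩
    (2 + m) * (2 + m) * S (2 + m) + 32 * (suc m * suc m) * S m
  ∎)
  where
  open ≡-Reasoning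
  T  = partial (suc m)
  S₁ = S (suc m)
  regroup : ∀ m t s s₁ →
    4 * (8 * t + suc m * s₁) + 4 * ((2 + m) * (2 + m)) * s₁ + 32 * (suc m * suc m) * s
      ≡ 8 * (4 * t + 4 * (suc m * suc m) * s) + 4 * suc m * s₁ + 4 * ((2 + m) * (2 + m)) * s₁
  regroup = solve-∀
  collect : ∀ m s₁ → 8 * (suc m * suc m * s₁) + 4 * suc m * s₁ + 4 * ((2 + m) * (2 + m)) * s₁
                   ≡ 4 * (3 * (m * m) + 9 * m + 7) * s₁
  collect = solve-∀

-- Hence  m² (S_m - 4 S_{m-1}) = 4 T(m)  for m ≥ 1 (the subtraction is exact).
partial-closed : ∀ q → suc q * suc q * (S (suc q) ∸ 4 * S q) ≡ 4 * partial (suc q)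
partial-closed q = begin
    m² * (S (suc q) ∸ 4 * S q)
  ≡⟨ *-distribˡ-∸ m² (S (suc q)) (4 * S q) ⟩
    m² * S (suc q) ∸ m² * (4 * S q)
  ≡⟨ cong₂ _∸_ (sym (partial-identity q)) (x*[4*y]≡4*x*y m² (S q)) ⟩
    4 * partial (suc q) + 4 * m² * S q ∸ 4 * m² * S q
  ≡⟨ m+n∸n≡m (4 * partial (suc q)) (4 * m² * S q) ⟩
    4 * partial (suc q)
  ∎
  where
  open ≡-Reasoning
  m² = suc q * suc q
  x*[4*y]≡4*x*y : ∀ x y → x * (4 * y) ≡ 4 * x * y
  x*[4*y]≡4*x*y = solve-∀

toℚᵘ-frac : ∀ a b .{{_ : NonZero b}} → ℚ.toℚᵘ ((+ a) ℚ./ b) ℚᵘ.≃ mkℚᵘ (+ a) (pred b)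
toℚᵘ-frac a (suc b) = ℚP.toℚᵘ-fromℚᵘ (mkℚᵘ (+ a) b)

pos-cross : ∀ x y z w → x * y ≡ z * w → (+ x) ℤ.* (+ y) ≡ (+ z) ℤ.* (+ w)
pos-cross x y z w eq = trans (sym (ℤP.pos-* x y)) (trans (cong +_ eq) (ℤP.pos-* z w))

fraction-sum : ∀ a b c d e f .{{_ : NonZero b}} .{{_ : NonZero d}} .{{_ : NonZero f}} →
  (a * d + c * b) * f ≡ e * (b * d) →
  ((+ a) ℚ./ b) ℚ.+ ((+ c) ℚ./ d) ≡ (+ e) ℚ./ f
fraction-sum a (suc b) c (suc d) e (suc f) cross = ℚP.toℚᵘ-injective (begin
    ℚ.toℚᵘ (((+ a) ℚ./ suc b) ℚ.+ ((+ c) ℚ./ suc d))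
  ≈⟨ ℚP.toℚᵘ-homo-+ ((+ a) ℚ./ suc b) ((+ c) ℚ./ suc d) ⟩
    ℚ.toℚᵘ ((+ a) ℚ./ suc b) ℚᵘ.+ ℚ.toℚᵘ ((+ c) ℚ./ suc d)
  ≈⟨ ℚᵘP.+-cong (toℚᵘ-frac a (suc b)) (toℚᵘ-frac c (suc d)) ⟩
    mkℚᵘ (+ a) b ℚᵘ.+ mkℚᵘ (+ c) d
  ≈⟨ *≡* (trans (cong (ℤ._* (+ suc f)) (sym numerator)) (pos-cross (a * suc d + c * suc b) (suc f) e _ cross)) ⟩
    mkℚᵘ (+ e) f
  ≈⟨ ℚᵘP.≃-sym (toℚᵘ-frac e (suc f)) ⟩
    ℚ.toℚᵘ ((+ e) ℚ./ suc f)
  ∎)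
  where
  open ℚᵘP.≃-Reasoning
  numerator : + (a * suc d + c * suc b) ≡ (+ a) ℤ.* (+ suc d) ℤ.+ (+ c) ℤ.* (+ suc b)
  numerator = trans (ℤP.pos-+ (a * suc d) (c * suc b)) (cong₂ ℤ._+_ (ℤP.pos-* a (suc d)) (ℤP.pos-* c (suc b)))

fraction-product : ∀ a b c d e f .{{_ : NonZero b}} .{{_ : NonZero d}} .{{_ : NonZero f}} →
  (a * c) * f ≡ e * (b * d) →
  ((+ a) ℚ./ b) ℚ.* ((+ c) ℚ./ d) ≡ (+ e) ℚ./ f
fraction-product a (suc b) c (suc d) e (suc f) cross = ℚP.toℚᵘ-injective (begin
    ℚ.toℚᵘ (((+ a) ℚ./ suc b) ℚ.* ((+ c) ℚ./ suc d))
  ≈⟨ ℚP.toℚᵘ-homo-* ((+ a) ℚ./ suc b) ((+ c) ℚ./ suc d) ⟩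
    ℚ.toℚᵘ ((+ a) ℚ./ suc b) ℚᵘ.* ℚ.toℚᵘ ((+ c) ℚ./ suc d)
  ≈⟨ ℚᵘP.*-cong (toℚᵘ-frac a (suc b)) (toℚᵘ-frac c (suc d)) ⟩
    mkℚᵘ (+ a) b ℚᵘ.* mkℚᵘ (+ c) d
  ≈⟨ *≡* (trans (cong (ℤ._* (+ suc f)) (sym (ℤP.pos-* a c))) (pos-cross (a * c) (suc f) e _ cross)) ⟩
    mkℚᵘ (+ e) f
  ≈⟨ ℚᵘP.≃-sym (toℚᵘ-frac e (suc f)) ⟩
    ℚ.toℚᵘ ((+ e) ℚ./ suc f)
  ∎)
  where open ℚᵘP.≃-Reasoning

partial-sum-formula : ∀ M → sumℚ1 M term ≡ ((+ partial (suc M)) ℚ./ (8 ^ M)) {{m^n≢0 8 M}}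
partial-sum-formula zero    = refl
partial-sum-formula (suc M) = trans (cong (ℚ._+ term (suc M)) (partial-sum-formula M))
  (fraction-sum (partial (suc M)) (8 ^ M) (suc M * S (suc M)) (8 ^ suc M)
     (partial (2 + M)) (8 ^ suc M) {{m^n≢0 8 M}} {{m^n≢0 8 (suc M)}} {{m^n≢0 8 (suc M)}}
     (common-denominator (partial (suc M)) (suc M * S (suc M)) (8 ^ M)))
  where
  common-denominator : ∀ t c x → (t * (8 * x) + c * x) * (8 * x) ≡ (8 * t + c) * (x * (8 * x))
  common-denominator = solve-∀

prime∤power : ∀ {p m} → Prime p → ¬ p ∣ m → ∀ k → ¬ p ∣ m ^ k
prime∤power pr p∤m zero    p∣1 = ¬prime[1] (subst Prime (∣1⇒≡1 p∣1) pr)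
prime∤power {m = m} pr p∤m (suc k) p∣mᵏ⁺¹ with euclidsLemma m (m ^ k) pr p∣mᵏ⁺¹
... | inj₁ p∣m  = p∤m p∣m
... | inj₂ p∣mᵏ = prime∤power pr p∤m k p∣mᵏ

odd-prime∤2 : ∀ {p} → Prime p → ¬ 2 ∣ p → ¬ p ∣ 2
odd-prime∤2 {p} pr odd p∣2 = odd (subst (2 ∣_) (sym p≡2) ∣-refl)
  where
  p≡2 : p ≡ 2
  p≡2 = ≤-antisym (∣⇒≤ p∣2) (nonTrivial⇒n>1 p {{prime⇒nonTrivial pr}})

-- 8 = 2³, so an odd prime divides no power of 8.
odd-prime∤8^k : ∀ {p} → Prime p → ¬ 2 ∣ p → ∀ k → ¬ p ∣ 8 ^ k
odd-prime∤8^k pr odd = prime∤power pr (prime∤power pr (odd-prime∤2 pr odd) 3)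

-- The reduced denominator of a/n divides n (the gcd is what was cancelled).
denominator∣ : ∀ a n .{{_ : NonZero n}} → ℚ.denominatorℕ ((+ a) ℚ./ n) ∣ n
denominator∣ a n = divides (gcd a n) (ℤP.+-injective (begin-equality
    (+ n)
  ≡⟨ sym (ℚP.↧-/ (+ a) n) ⟩
    ℚ.↧ ((+ a) ℚ./ n) ℤ.* (+ gcd a n)
  ≡⟨ sym (ℤP.pos-* (ℚ.denominatorℕ ((+ a) ℚ./ n)) (gcd a n)) ⟩
    (+ (ℚ.denominatorℕ ((+ a) ℚ./ n) * gcd a n))
  ≡⟨ cong +_ (*-comm _ (gcd a n)) ⟩
    (+ (gcd a n * ℚ.denominatorℕ ((+ a) ℚ./ n)))
  ∎))
  where open ℤP.≤-Reasoning

-- The closed form with denominators cleared: from  s² D = 4t  we get  s² · 2D · x = t · 8x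
-- (written with  s * (s * 1) = s ^ 2  and  1 * (8 * x)  as produced by fraction-product).
clear-denominators : ∀ s D t x → s * s * D ≡ 4 * t → s * (s * 1) * (2 * D) * x ≡ t * (1 * (8 * x))
clear-denominators s D t x s²D≡4t = begin
    s * (s * 1) * (2 * D) * x  ≡⟨ double-square s D x ⟩
    2 * (s * s * D) * x        ≡⟨ cong (λ y → 2 * y * x) s²D≡4t ⟩
    2 * (4 * t) * x            ≡⟨ eight t x ⟩
    t * (1 * (8 * x))          ∎
  where
  open ≡-Reasoning
  double-square : ∀ s D x → s * (s * 1) * (2 * D) * x ≡ 2 * (s * s * D) * x
  double-square = solve-∀
  eight : ∀ t x → 2 * (4 * t) * x ≡ t * (1 * (8 * x))
  eight = solve-∀

theorem4p3 : (p : ℕ) → Prime p → ¬ (2 ∣ p) →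
    CongMod p (sumℚ1 (p ∸ 1) term) (ofℕ 0) (p ^ 2)
theorem4p3 zero    pr odd = ⊥-elim (odd (divides 0 refl))
theorem4p3 (suc q) pr odd = r , p∤denominator , sum≡p²r
  where
  instance
    8^q≢0 : NonZero (8 ^ q)
    8^q≢0 = m^n≢0 8 q
    8^p≢0 : NonZero (8 ^ suc q)
    8^p≢0 = m^n≢0 8 (suc q)
  D = S (suc q) ∸ 4 * S q
  r : ℚ
  r = (+ (2 * D)) ℚ./ (8 ^ suc q)
  p∤denominator : ¬ suc q ∣ ℚ.denominatorℕ r
  p∤denominator p∣den = odd-prime∤8^k pr odd (suc q) (∣-trans p∣den (denominator∣ (2 * D) (8 ^ suc q)))
  sum≡p²r : sumℚ1 q term ℚ.- ofℕ 0 ≡ ofℕ (suc q ^ 2) ℚ.* r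
  sum≡p²r = begin
      sumℚ1 q term ℚ.- ofℕ 0
    ≡⟨ ℚP.+-identityʳ (sumℚ1 q term) ⟩
      sumℚ1 q term
    ≡⟨ partial-sum-formula q ⟩
      (+ partial (suc q)) ℚ./ (8 ^ q)
    ≡⟨ sym (fraction-product (suc q ^ 2) 1 (2 * D) (8 ^ suc q) (partial (suc q)) (8 ^ q)
             (clear-denominators (suc q) D (partial (suc q)) (8 ^ q) (partial-closed q))) ⟩
      ofℕ (suc q ^ 2) ℚ.* r
    ∎
    where open ≡-Reasoning
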